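{- For every fixed $k \ge 3$, any streaming algorithm for \textsc{Diameter} in the VA model that works on all graphs with vertex cover number at most $k$ and uses $p$ passes over the stream requires $\Omega(n/p)$ bits of memory on $n$-vertex graphs.
   Context: Graphs are finite, simple, undirected, unweighted. The vertex cover number is the minimum size of a vertex set meeting every edge. \textsc{Diameter}: compute $\max_{s,t} d(s,t)$ (shortest-path distance). In the Vertex Arrival (VA) streaming model, the vertices arrive one by one in an arbitrary fixed order, and each edge is revealed when the later of its two endpoints arrives (together with that vertex). A $p$-pass algorithm reads the stream $p$ times with unlimited computation; memory is measured in bits. "Requires $\Omega(f)$ bits" means there is a constant $c>0$ such that every such algorithm uses at least $c\cdot f$ bits on some $n$-vertex input of the class, for all sufficiently large $n$ and all $p$. -}

module Defs where

open import Data.Nat using (ℕ; zero; suc; _+_; _*_; _^_; _≤_; _<_)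
open import Data.Bool using (Bool; true; false)
open import Data.Fin using (Fin)
open import Data.Fin.Subset using (Subset; ⁅_⁆; _∈_; _∩_; _∪_; ∣_∣; ⊥)
open import Data.Vec using (tabulate)
open import Data.List using (List; []; _∷_; foldl; allFin)
open import Data.List.Relation.Binary.Permutation.Propositional using (_↭_)
open import Data.Maybe using (Maybe; just; nothing)
open import Data.Product using (Σ; _×_; _,_; ∃)
open import Data.Sum using (_⊎_)
open import Relation.Nullary using (¬_)
open import Relation.Binary.PropositionalEquality using (_≡_)

record Graph (n : ℕ) : Set where
  field
    adj   : Fin n → Fin n → Bool
    sym   : ∀ u v → adj u v ≡ adj v u
    irrefl : ∀ v → adj v v ≡ false
open Graph public

VCNumberAtMost : ∀ {n} → Graph n → ℕ → Set
VCNumberAtMost {n} G k =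
  Σ (Subset n) λ C → (∣ C ∣ ≤ k) × (∀ u v → adj G u v ≡ true → (u ∈ C) ⊎ (v ∈ C))

data Walk {n : ℕ} (G : Graph n) : Fin n → Fin n → ℕ → Set where
  here : ∀ v → Walk G v v 0
  step : ∀ {u v w ℓ} → adj G u v ≡ true → Walk G v w ℓ → Walk G u w (suc ℓ)

Dist : ∀ {n} → Graph n → Fin n → Fin n → ℕ → Set
Dist G s t d = Walk G s t d × (∀ ℓ → ℓ < d → ¬ Walk G s t ℓ)

-- Diameter = max_{s,t} d(s,t); value `nothing` encodes ∞ (disconnected graph).
IsDiameter : ∀ {n} → Graph n → Maybe ℕ → Set
IsDiameter {n} G (just D) =
  (∀ s t → ∃ λ d → Dist G s t d × d ≤ D) × (Σ (Fin n) λ s → Σ (Fin n) λ t → Dist G s t D)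
IsDiameter {n} G nothing =
  Σ (Fin n) λ s → Σ (Fin n) λ t → ∀ ℓ → ¬ Walk G s t ℓ

-- VA stream item: the arriving vertex with its set of neighbours that arrived earlier.
Item : ℕ → Set
Item n = Fin n × Subset n

neighbourhood : ∀ {n} → Graph n → Fin n → Subset n
neighbourhood G v = tabulate (λ u → adj G v u)

streamFrom : ∀ {n} → Graph n → Subset n → List (Fin n) → List (Item n)
streamFrom G seen [] = []
streamFrom G seen (v ∷ vs) =
  (v , (neighbourhood G v ∩ seen)) ∷ streamFrom G (seen ∪ ⁅ v ⁆) vs

vaStream : ∀ {n} → Graph n → List (Fin n) → List (Item n)
vaStream G order = streamFrom G ⊥ order

-- A deterministic p-pass VA streaming algorithm for n-vertex graphs using s bits:
-- memory states are Fin (2 ^ s); unlimited computation per item; the pass index is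
-- given for free; the output (Maybe ℕ, nothing = ∞) is a function of the final state.
record VAAlgorithm (n p s : ℕ) : Set where
  field
    init   : Fin (2 ^ s)
    update : Fin p → Fin (2 ^ s) → Item n → Fin (2 ^ s)
    output : Fin (2 ^ s) → Maybe ℕ
open VAAlgorithm public

runPasses : ∀ {n} (s p : ℕ) → (Fin p → Fin (2 ^ s) → Item n → Fin (2 ^ s)) →
            List (Item n) → Fin (2 ^ s) → Fin (2 ^ s)
runPasses s zero f str q = q
runPasses s (suc p) f str q =
  runPasses s p (λ i → f (Data.Fin.suc i)) str (foldl (f Data.Fin.zero) q str)

run : ∀ {n p s} → VAAlgorithm n p s → List (Item n) → Maybe ℕ
run {p = p} {s} A str = output A (runPasses s p (update A) str (init A))

SolvesDiameterVC : ∀ {n p s} → ℕ → VAAlgorithm n p s → Set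
SolvesDiameterVC {n} k A =
  ∀ (G : Graph n) (order : List (Fin n)) → order ↭ allFin n → VCNumberAtMost G k →
  IsDiameter G (run A (vaStream G order))

-- A reduction from two-party communication.  In the gadget (hubs yHub, nHub, xHub, which
-- form a vertex cover, a vertex link and one vertex elt i per index i < m) xHub arrives last, so
-- the vertex-arrival stream is Alice's part, determined by a bit string y, followed by Bob's
-- final item, determined by a bit string x.  For y = not ∘ x the gadget is disconnected
-- (diameter ∞), while it is connected as soon as x i = y i = true for some i.  A p-pass algorithm
-- with s bits of memory is a protocol whose transcript is the 2p memory states at the boundaries
-- between the two parts, and runs with equal transcripts can be cut and pasted.  If x ≠ x′ had
-- equal transcripts, say x i = true and x′ i = false, the connected input (x, not ∘ x′) would get
-- the answer of the disconnected input (x′, not ∘ x′).  So x ↦ transcript is injective, whence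
-- 2 ^ m ≤ 2 ^ (2ps) and n = m + 4 ≤ 6ps.
module Submission where

open import Defs
open import Data.Nat using (ℕ; _*_; _≤_)
open import Data.Product using (Σ; _×_)

open import Data.Bool using (Bool; true; false; not; _∧_; _∨_)
open import Data.Bool.Properties using (∧-zeroʳ; ∨-zeroʳ; ∨-comm; not-involutive; not-injective)
open import Data.Empty using (⊥-elim)
open import Data.Fin using (Fin; zero; suc; combine; funToFin; finToFun)
open import Data.Fin.Properties
  using (2↔Bool; injective⇒≤; funToFin-finToFin; finToFun-funToFin)
open import Data.Fin.Subset using (Subset; inside; outside; ⊥; ⁅_⁆; _∪_; _∩_; _∈_; ∣_∣)
open import Data.Fin.Subset.Properties using (∉⊥; ∣⊥∣≡0; x∈p∪q⁻; x∈⁅y⁆⇒x≡y)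
open import Data.List as List using (List; []; _∷_; _++_; foldl; allFin)
open import Data.List.Properties using (foldl-++)
open import Data.List.Relation.Unary.All using (All; []; _∷_)
open import Data.List.Relation.Unary.All.Properties using (tabulate⁺)
open import Data.List.Relation.Binary.Permutation.Propositional using (_↭_; prep)
open import Data.List.Relation.Binary.Permutation.Propositional.Properties using (++-comm)
open import Data.Maybe using (Maybe; just; nothing)
open import Data.Nat using (zero; suc; _+_; _^_; z≤n; s≤s)
open import Data.Nat.Properties
  using (≤-trans; ≤-reflexive; <⇒≱; ≮⇒≥; +-mono-≤; m≤m*n; *-distribʳ-+; ^-*-assoc; ^-monoʳ-<)
open import Data.Nat.Tactic.RingSolver using (solve-∀)
open import Data.Product using (∃; _,_; map)
open import Data.Sum using (_⊎_; inj₁; inj₂; [_,_]; swap)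
open import Data.Vec using (Vec; []; _∷_; lookup; tabulate; here; there)
open import Data.Vec.Properties using (∷-injective; tabulate∘lookup; tabulate-cong)
open import Function using (_∘_; Inverse)
open import Relation.Binary.PropositionalEquality as Eq
  using (_≡_; _≢_; _≗_; refl; trans; cong; cong₂; subst; module ≡-Reasoning)
open import Relation.Nullary using (¬_)

private variable
  m n k : ℕ

∨≡true⁻ : ∀ b {c} → b ∨ c ≡ true → b ≡ true ⊎ c ≡ true
∨≡true⁻ true  _ = inj₁ refl
∨≡true⁻ false e = inj₂ e

≡true-⇔⇒≡ : ∀ {b c} → (b ≡ true → c ≡ true) → (c ≡ true → b ≡ true) → b ≡ c
≡true-⇔⇒≡ {false} {false} _ _ = refl
≡true-⇔⇒≡ {false} {true}  _ c⇒b = c⇒b refl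
≡true-⇔⇒≡ {true}  {false} b⇒c _ = Eq.sym (b⇒c refl)
≡true-⇔⇒≡ {true}  {true}  _ _ = refl

orientedGraph : (h : Fin n → Fin n → Bool) → (∀ v → h v v ≡ false) → Graph n
orientedGraph h h-irrefl = record
  { adj    = λ u v → h u v ∨ h v u
  ; sym    = λ u v → ∨-comm (h u v) (h v u)
  ; irrefl = λ v → cong₂ _∨_ (h-irrefl v) (h-irrefl v)
  }

module _ (h : Fin n → Fin n → Bool) (h-irrefl : ∀ v → h v v ≡ false) where

  private
    G : Graph n
    G = orientedGraph h h-irrefl

  orientedGraph-adj⁺ : ∀ u v → h u v ≡ true → adj G u v ≡ true
  orientedGraph-adj⁺ u v e = cong (_∨ h v u) e

  orientedGraph-adj⁻ : ∀ u v → h v u ≡ true → adj G u v ≡ true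
  orientedGraph-adj⁻ u v e = trans (cong (h u v ∨_) e) (∨-zeroʳ (h u v))

  orientedGraph-edge : ∀ u v → adj G u v ≡ true → h u v ≡ true ⊎ h v u ≡ true
  orientedGraph-edge u v = ∨≡true⁻ (h u v)

Reachable : Graph n → Fin n → Fin n → Set
Reachable G s t = ∃ (Walk G s t)

Connected : Graph n → Set
Connected G = ∀ s t → Reachable G s t

module _ {G : Graph n} where

  reachable-refl : ∀ v → Reachable G v v
  reachable-refl v = 0 , here v

  adj⇒reachable : ∀ {u v} → adj G u v ≡ true → Reachable G u v
  adj⇒reachable e = 1 , step e (here _)

  reachable-trans : ∀ {s t r} → Reachable G s t → Reachable G t r → Reachable G s r
  reachable-trans (_ , here _)   t↝r = t↝r
  reachable-trans (_ , step e w) t↝r = map suc (step e) (reachable-trans (_ , w) t↝r)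

  reachable-sym : ∀ {s t} → Reachable G s t → Reachable G t s
  reachable-sym (_ , here _) = reachable-refl _
  reachable-sym (_ , step {u} {v} e w) =
    reachable-trans (reachable-sym (_ , w)) (adj⇒reachable (trans (sym G v u) e))

  connected-via : ∀ c → (∀ v → Reachable G v c) → Connected G
  connected-via c ↝c s t = reachable-trans (↝c s) (reachable-sym (↝c t))

  walk-invariant : ∀ {A : Set} (f : Fin n → A) → (∀ u v → adj G u v ≡ true → f u ≡ f v) →
                   ∀ {s t ℓ} → Walk G s t ℓ → f s ≡ f t
  walk-invariant f f-edge (here _)   = refl
  walk-invariant f f-edge (step e w) = trans (f-edge _ _ e) (walk-invariant f f-edge w)

isDiameter-just⇒connected : ∀ {G : Graph n} {D} → IsDiameter G (just D) → Connected G
isDiameter-just⇒connected (dist , _) s t with dist s t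
... | d , (w , _) , _ = d , w

isDiameter-nothing⇒disconnected : ∀ {G : Graph n} → IsDiameter G nothing → ¬ Connected G
isDiameter-nothing⇒disconnected (s , t , noWalk) conn with conn s t
... | ℓ , w = noWalk ℓ w

sameDiameter⇒connected : ∀ {G G′ : Graph n} {o} → IsDiameter G o → IsDiameter G′ o →
                         Connected G → Connected G′
sameDiameter⇒connected {o = nothing} diam _ conn =
  ⊥-elim (isDiameter-nothing⇒disconnected diam conn)
sameDiameter⇒connected {o = just _} _ diam′ _ = isDiameter-just⇒connected diam′

-- Vertex-arrival streams

seenAfter : Subset n → List (Fin n) → Subset n
seenAfter seen []       = seen
seenAfter seen (v ∷ vs) = seenAfter (seen ∪ ⁅ v ⁆) vs

streamFrom-++ : ∀ (G : Graph n) seen xs ys →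
  streamFrom G seen (xs ++ ys) ≡ streamFrom G seen xs ++ streamFrom G (seenAfter seen xs) ys
streamFrom-++ G seen []       ys = refl
streamFrom-++ G seen (v ∷ xs) ys = cong (_ ∷_) (streamFrom-++ G (seen ∪ ⁅ v ⁆) xs ys)

tabulate-∩-cong : ∀ (f g : Fin n → Bool) (S : Subset n) → (∀ {u} → u ∈ S → f u ≡ g u) →
                  tabulate f ∩ S ≡ tabulate g ∩ S
tabulate-∩-cong f g []            _  = refl
tabulate-∩-cong f g (inside ∷ S)  eq =
  cong₂ _∷_ (cong (_∧ true) (eq here)) (tabulate-∩-cong (f ∘ suc) (g ∘ suc) S (eq ∘ there))
tabulate-∩-cong f g (outside ∷ S) eq =
  cong₂ _∷_ (trans (∧-zeroʳ (f zero)) (Eq.sym (∧-zeroʳ (g zero))))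
            (tabulate-∩-cong (f ∘ suc) (g ∘ suc) S (eq ∘ there))

module _ {G G′ : Graph n} (P : Fin n → Set)
         (agree : ∀ {u v} → P u → P v → adj G u v ≡ adj G′ u v) where

  streamFrom-cong : ∀ {seen} vs → (∀ {u} → u ∈ seen → P u) → All P vs →
                    streamFrom G seen vs ≡ streamFrom G′ seen vs
  streamFrom-cong []       _       []         = refl
  streamFrom-cong {seen} (v ∷ vs) seen⊆P (Pv ∷ Pvs) =
    cong₂ _∷_ (cong (v ,_) neighbours-agree) (streamFrom-cong vs seen∪v⊆P Pvs)
    where
    neighbours-agree : neighbourhood G v ∩ seen ≡ neighbourhood G′ v ∩ seen
    neighbours-agree =
      tabulate-∩-cong (adj G v) (adj G′ v) seen (λ u∈seen → agree Pv (seen⊆P u∈seen))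

    seen∪v⊆P : ∀ {u} → u ∈ seen ∪ ⁅ v ⁆ → P u
    seen∪v⊆P {u} u∈ = [ seen⊆P , (λ u∈v → subst P (Eq.sym (x∈⁅y⁆⇒x≡y v u∈v)) Pv) ]
                        (x∈p∪q⁻ seen ⁅ v ⁆ u∈)

-- The memory contents at the two points of each pass where the stream crosses from α to β and
-- from β back to α: the messages of the two-party protocol simulated by the algorithm.
passBoundaries : ∀ s p → (Fin p → Fin (2 ^ s) → Item n → Fin (2 ^ s)) →
                 List (Item n) → List (Item n) → Fin (2 ^ s) → Vec (Fin (2 ^ s)) (p * 2)
passBoundaries s zero    f α β q = []
passBoundaries s (suc p) f α β q = q₁ ∷ q₂ ∷ passBoundaries s p (f ∘ suc) α β q₂
  where
  q₁ = foldl (f zero) q α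
  q₂ = foldl (f zero) q₁ β

runPasses-cut : ∀ s p (f : Fin p → Fin (2 ^ s) → Item n → Fin (2 ^ s))
  (α β α′ β′ : List (Item n)) (q : Fin (2 ^ s)) →
  passBoundaries s p f α β q ≡ passBoundaries s p f α′ β′ q →
  runPasses s p f (α ++ β′) q ≡ runPasses s p f (α ++ β) q
runPasses-cut s zero    f α β α′ β′ q _  = refl
runPasses-cut s (suc p) f α β α′ β′ q eq with ∷-injective eq
... | eq₁ , eq′ with ∷-injective eq′
... | eq₂ , eq-rest = begin
    runPasses s p f′ (α ++ β′) (foldl (f zero) q (α ++ β′))
  ≡⟨ cong (runPasses s p f′ (α ++ β′)) first-pass ⟩
    runPasses s p f′ (α ++ β′) q₂
  ≡⟨ runPasses-cut s p f′ α β α′ β′ q₂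
       (trans eq-rest (cong (passBoundaries s p f′ α′ β′) (Eq.sym eq₂))) ⟩
    runPasses s p f′ (α ++ β) q₂
  ≡⟨ cong (runPasses s p f′ (α ++ β)) (Eq.sym (foldl-++ (f zero) q α β)) ⟩
    runPasses s p f′ (α ++ β) (foldl (f zero) q (α ++ β))
  ∎
  where
  open ≡-Reasoning
  f′ : Fin p → Fin (2 ^ s) → Item _ → Fin (2 ^ s)
  f′ = f ∘ suc

  q₂ : Fin (2 ^ s)
  q₂ = foldl (f zero) (foldl (f zero) q α) β

  first-pass : foldl (f zero) q (α ++ β′) ≡ q₂
  first-pass = begin
      foldl (f zero) q (α ++ β′)              ≡⟨ foldl-++ (f zero) q α β′ ⟩
      foldl (f zero) (foldl (f zero) q α) β′  ≡⟨ cong (λ q₁ → foldl (f zero) q₁ β′) eq₁ ⟩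
      foldl (f zero) (foldl (f zero) q α′) β′ ≡⟨ Eq.sym eq₂ ⟩
      q₂                                      ∎

funToFin-cong : ∀ {f g : Fin m → Fin k} → f ≗ g → funToFin f ≡ funToFin g
funToFin-cong {zero}  _   = refl
funToFin-cong {suc m} f≗g = cong₂ combine (f≗g zero) (funToFin-cong (f≗g ∘ suc))

funToFin∘lookup-injective : ∀ {A : ℕ} (v w : Vec (Fin A) m) →
  funToFin (lookup v) ≡ funToFin (lookup w) → v ≡ w
funToFin∘lookup-injective v w eq = begin
    v                    ≡⟨ Eq.sym (tabulate∘lookup v) ⟩
    tabulate (lookup v)  ≡⟨ tabulate-cong lookups-agree ⟩
    tabulate (lookup w)  ≡⟨ tabulate∘lookup w ⟩
    w                    ∎
  where
  open ≡-Reasoning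
  lookups-agree : lookup v ≗ lookup w
  lookups-agree i = begin
    lookup v i                           ≡⟨ Eq.sym (finToFun-funToFin (lookup v) i) ⟩
    finToFun (funToFin (lookup v)) i     ≡⟨ cong (λ c → finToFun c i) eq ⟩
    finToFun (funToFin (lookup w)) i     ≡⟨ finToFun-funToFin (lookup w) i ⟩
    lookup w i                           ∎

bitString-injection⇒2^≤ : ∀ {K} (code : (Fin m → Bool) → Fin K) →
  (∀ {x y} → code x ≡ code y → x ≗ y) → 2 ^ m ≤ K
bitString-injection⇒2^≤ {m} code code-injective = injective⇒≤ decode-injective
  where
  open Inverse 2↔Bool using (to; from; strictlyInverseʳ)

  bits : Fin (2 ^ m) → Fin m → Fin 2
  bits = finToFun

  decode : Fin (2 ^ m) → Fin m → Bool
  decode i = to ∘ bits i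

  decode-injective : ∀ {i j} → code (decode i) ≡ code (decode j) → i ≡ j
  decode-injective {i} {j} eq = begin
      i                   ≡⟨ Eq.sym (funToFin-finToFin {m} {2} i) ⟩
      funToFin (bits i)   ≡⟨ funToFin-cong bits-agree ⟩
      funToFin (bits j)   ≡⟨ funToFin-finToFin {m} {2} j ⟩
      j                   ∎
    where
    open ≡-Reasoning
    bits-agree : bits i ≗ bits j
    bits-agree r = begin
      bits i r             ≡⟨ Eq.sym (strictlyInverseʳ (bits i r)) ⟩
      from (to (bits i r)) ≡⟨ cong from (code-injective eq r) ⟩
      from (to (bits j r)) ≡⟨ strictlyInverseʳ (bits j r) ⟩
      bits j r             ∎

2^-cancel-≤ : ∀ {a b} → 2 ^ a ≤ 2 ^ b → a ≤ b
2^-cancel-≤ 2^a≤2^b = ≮⇒≥ (λ b<a → <⇒≱ (^-monoʳ-< 2 (s≤s (s≤s z≤n)) b<a) 2^a≤2^b)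

*-double-comm : ∀ p s → s * (p * 2) ≡ 2 * (p * s)
*-double-comm = solve-∀

4+m≤6*t : ∀ {m t} → 1 ≤ m → m ≤ 2 * t → 4 + m ≤ 6 * t
4+m≤6*t {t = zero}  (s≤s z≤n) ()
4+m≤6*t {t = suc t} _ m≤2t =
  ≤-trans (+-mono-≤ (m≤m*n 4 (suc t)) m≤2t) (≤-reflexive (Eq.sym (*-distribʳ-+ (suc t) 4 2)))

-- The gadget

pattern yHub   = zero
pattern nHub   = suc zero
pattern link   = suc (suc zero)
pattern xHub   = suc (suc (suc zero))
pattern elt i  = suc (suc (suc (suc i)))

module Gadget {m : ℕ} where

  Vertex : Set
  Vertex = Fin (4 + m)

  xEdges : (Fin m → Bool) → Vertex → Bool
  xEdges x (elt i) = x i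
  xEdges x _       = false

  yEdges : (Fin m → Bool) → Vertex → Vertex → Bool
  yEdges y yHub (elt i) = y i
  yEdges y nHub (elt i) = not (y i)
  yEdges y nHub link    = true
  yEdges y link xHub    = true
  yEdges y _    _       = false

  arcs : (x y : Fin m → Bool) → Vertex → Vertex → Bool
  arcs x y xHub v = xEdges x v
  arcs x y u    v = yEdges y u v

  arcs-irrefl : ∀ x y v → arcs x y v v ≡ false
  arcs-irrefl x y yHub    = refl
  arcs-irrefl x y nHub    = refl
  arcs-irrefl x y link    = refl
  arcs-irrefl x y xHub    = refl
  arcs-irrefl x y (elt _) = refl

  gadget : (x y : Fin m → Bool) → Graph (4 + m)
  gadget x y = orientedGraph (arcs x y) (arcs-irrefl x y)

  hubs : Subset (4 + m)
  hubs = inside ∷ inside ∷ outside ∷ inside ∷ ⊥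

  arcs-covered : ∀ x y u v → arcs x y u v ≡ true → u ∈ hubs ⊎ v ∈ hubs
  arcs-covered x y yHub    _       _  = inj₁ here
  arcs-covered x y nHub    _       _  = inj₁ (there here)
  arcs-covered x y xHub    _       _  = inj₁ (there (there (there here)))
  arcs-covered x y link    xHub    _  = inj₂ (there (there (there here)))
  arcs-covered x y link    yHub    ()
  arcs-covered x y link    nHub    ()
  arcs-covered x y link    link    ()
  arcs-covered x y link    (elt _) ()
  arcs-covered x y (elt _) _       ()

  gadget-vertexCover : 3 ≤ k → ∀ x y → VCNumberAtMost (gadget x y) k
  gadget-vertexCover {k} 3≤k x y = hubs , subst (_≤ k) (Eq.sym ∣hubs∣≡3) 3≤k , covered
    where
    ∣hubs∣≡3 : ∣ hubs ∣ ≡ 3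
    ∣hubs∣≡3 = cong (3 +_) (∣⊥∣≡0 m)

    covered : ∀ u v → adj (gadget x y) u v ≡ true → u ∈ hubs ⊎ v ∈ hubs
    covered u v e = [ arcs-covered x y u v , swap ∘ arcs-covered x y v u ]
                      (orientedGraph-edge (arcs x y) (arcs-irrefl x y) u v e)

  module _ (x y : Fin m → Bool) where

    private
      arc : ∀ u v → arcs x y u v ≡ true → Reachable (gadget x y) u v
      arc u v = adj⇒reachable ∘ orientedGraph-adj⁺ (arcs x y) (arcs-irrefl x y) u v

      arc⁻ : ∀ u v → arcs x y v u ≡ true → Reachable (gadget x y) u v
      arc⁻ u v = adj⇒reachable ∘ orientedGraph-adj⁻ (arcs x y) (arcs-irrefl x y) u v

    gadget-connected : ∀ {r} → x r ≡ true → y r ≡ true → Connected (gadget x y)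
    gadget-connected {r} xr yr = connected-via xHub reaches-xHub
      where
      link↝xHub : Reachable (gadget x y) link xHub
      link↝xHub = arc link xHub refl

      nHub↝xHub : Reachable (gadget x y) nHub xHub
      nHub↝xHub = reachable-trans (arc nHub link refl) link↝xHub

      yHub↝xHub : Reachable (gadget x y) yHub xHub
      yHub↝xHub = reachable-trans (arc yHub (elt r) yr) (arc⁻ (elt r) xHub xr)

      reaches-xHub : ∀ v → Reachable (gadget x y) v xHub
      reaches-xHub yHub = yHub↝xHub
      reaches-xHub nHub = nHub↝xHub
      reaches-xHub link = link↝xHub
      reaches-xHub xHub = reachable-refl xHub
      reaches-xHub (elt i) with x i in xi | y i in yi
      ... | true  | _     = arc⁻ (elt i) xHub xi
      ... | false | true  = reachable-trans (arc⁻ (elt i) yHub yi) yHub↝xHub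
      ... | false | false = reachable-trans (arc⁻ (elt i) nHub (cong not yi)) nHub↝xHub

  -- For y = not ∘ x no edge leaves the vertex set {nHub, link, xHub} ∪ x, which misses yHub.
  side : (Fin m → Bool) → Vertex → Bool
  side x yHub    = false
  side x (elt i) = x i
  side x _       = true

  arcs-preserve-side : ∀ x u v → arcs x (not ∘ x) u v ≡ true → side x u ≡ side x v
  arcs-preserve-side x yHub    (elt i) e = Eq.sym (not-injective {x i} {false} e)
  arcs-preserve-side x nHub    (elt i) e = Eq.sym (trans (Eq.sym (not-involutive (x i))) e)
  arcs-preserve-side x xHub    (elt i) e = Eq.sym e
  arcs-preserve-side x nHub    link    _ = refl
  arcs-preserve-side x link    xHub    _ = refl
  arcs-preserve-side x yHub    yHub    ()
  arcs-preserve-side x yHub    nHub    ()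
  arcs-preserve-side x yHub    link    ()
  arcs-preserve-side x yHub    xHub    ()
  arcs-preserve-side x nHub    yHub    ()
  arcs-preserve-side x nHub    nHub    ()
  arcs-preserve-side x nHub    xHub    ()
  arcs-preserve-side x link    yHub    ()
  arcs-preserve-side x link    nHub    ()
  arcs-preserve-side x link    link    ()
  arcs-preserve-side x link    (elt _) ()
  arcs-preserve-side x xHub    yHub    ()
  arcs-preserve-side x xHub    nHub    ()
  arcs-preserve-side x xHub    link    ()
  arcs-preserve-side x xHub    xHub    ()
  arcs-preserve-side x (elt _) _       ()

  gadget-disconnected : ∀ x → ¬ Connected (gadget x (not ∘ x))
  gadget-disconnected x conn with conn xHub yHub
  ... | _ , w with walk-invariant (side x) side-edge w
    where
    side-edge : ∀ u v → adj (gadget x (not ∘ x)) u v ≡ true → side x u ≡ side x v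
    side-edge u v e =
      [ arcs-preserve-side x u v , Eq.sym ∘ arcs-preserve-side x v u ]
        (orientedGraph-edge (arcs x (not ∘ x)) (arcs-irrefl x (not ∘ x)) u v e)
  ... | ()

  firstArrivals : List Vertex
  firstArrivals = yHub ∷ nHub ∷ link ∷ List.tabulate elt

  arrivalOrder : List Vertex
  arrivalOrder = firstArrivals ++ xHub ∷ []

  arrivalOrder-↭ : arrivalOrder ↭ allFin (4 + m)
  arrivalOrder-↭ = prep yHub (prep nHub (prep link (++-comm (List.tabulate elt) (xHub ∷ []))))

  -- Every edge depending on x leaves xHub and no edge at xHub depends on y, so the part of the
  -- stream before xHub is determined by y and the final item by x.
  aliceStream : (Fin m → Bool) → List (Item (4 + m))
  aliceStream y = streamFrom (gadget (λ _ → false) y) ⊥ firstArrivals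

  bobStream : (Fin m → Bool) → List (Item (4 + m))
  bobStream x = streamFrom (gadget x (λ _ → false)) (seenAfter ⊥ firstArrivals) (xHub ∷ [])

  arcs-off-xHub : ∀ {x x′} y u → u ≢ xHub → ∀ v → arcs x y u v ≡ arcs x′ y u v
  arcs-off-xHub y yHub    _ _ = refl
  arcs-off-xHub y nHub    _ _ = refl
  arcs-off-xHub y link    _ _ = refl
  arcs-off-xHub y xHub    u≢xHub _ = ⊥-elim (u≢xHub refl)
  arcs-off-xHub y (elt _) _ _ = refl

  xHub-neighbourhood : ∀ x y y′ →
    neighbourhood (gadget x y) xHub ≡ neighbourhood (gadget x y′) xHub
  xHub-neighbourhood x y y′ =
    tabulate-cong {f = adj (gadget x y) xHub} {g = adj (gadget x y′) xHub} λ where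
      yHub    → refl
      nHub    → refl
      link    → refl
      xHub    → refl
      (elt _) → refl

  vaStream-gadget : ∀ x y → vaStream (gadget x y) arrivalOrder ≡ aliceStream y ++ bobStream x
  vaStream-gadget x y = begin
      vaStream (gadget x y) arrivalOrder
    ≡⟨ streamFrom-++ (gadget x y) ⊥ firstArrivals (xHub ∷ []) ⟩
      streamFrom (gadget x y) ⊥ firstArrivals ++ streamFrom (gadget x y) seen (xHub ∷ [])
    ≡⟨ cong₂ _++_ alice bob ⟩
      aliceStream y ++ bobStream x
    ∎
    where
    open ≡-Reasoning
    seen = seenAfter ⊥ firstArrivals

    alice : streamFrom (gadget x y) ⊥ firstArrivals ≡ aliceStream y
    alice = streamFrom-cong {G = gadget x y} {G′ = gadget (λ _ → false) y} (_≢ xHub)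
      (λ {u} {v} u≢xHub v≢xHub →
        cong₂ _∨_ (arcs-off-xHub y u u≢xHub v) (arcs-off-xHub y v v≢xHub u))
      firstArrivals (⊥-elim ∘ ∉⊥) ((λ ()) ∷ (λ ()) ∷ (λ ()) ∷ tabulate⁺ (λ _ ()))

    bob : streamFrom (gadget x y) seen (xHub ∷ []) ≡ bobStream x
    bob = cong (λ N → (xHub , N ∩ seen) ∷ []) (xHub-neighbourhood x y (λ _ → false))

module _ {m p s k : ℕ} (3≤k : 3 ≤ k) (A : VAAlgorithm (4 + m) p s)
         (solves : SolvesDiameterVC k A) where
  open Gadget {m}

  private
    answer : Graph (4 + m) → Maybe ℕ
    answer G = run A (vaStream G arrivalOrder)

    answer-isDiameter : ∀ x y → IsDiameter (gadget x y) (answer (gadget x y))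
    answer-isDiameter x y =
      solves (gadget x y) arrivalOrder arrivalOrder-↭ (gadget-vertexCover 3≤k x y)

  transcript : (Fin m → Bool) → Vec (Fin (2 ^ s)) (p * 2)
  transcript x = passBoundaries s p (update A) (aliceStream (not ∘ x)) (bobStream x) (init A)

  answer-swap : ∀ {x x′} → transcript x ≡ transcript x′ →
                answer (gadget x (not ∘ x′)) ≡ answer (gadget x′ (not ∘ x′))
  answer-swap {x} {x′} eq = begin
      answer (gadget x (not ∘ x′))
    ≡⟨ cong (run A) (vaStream-gadget x (not ∘ x′)) ⟩
      run A (aliceStream (not ∘ x′) ++ bobStream x)
    ≡⟨ cong (output A) (runPasses-cut s p (update A) (aliceStream (not ∘ x′)) (bobStream x′)
                          (aliceStream (not ∘ x)) (bobStream x) (init A) (Eq.sym eq)) ⟩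
      run A (aliceStream (not ∘ x′) ++ bobStream x′)
    ≡⟨ cong (run A) (Eq.sym (vaStream-gadget x′ (not ∘ x′))) ⟩
      answer (gadget x′ (not ∘ x′))
    ∎
    where open ≡-Reasoning

  transcript-≡⇒⊆ : ∀ {x x′} → transcript x ≡ transcript x′ → ∀ {r} → x r ≡ true → x′ r ≡ true
  transcript-≡⇒⊆ {x} {x′} eq {r} xr with x′ r in x′r
  ... | true  = refl
  ... | false = ⊥-elim (gadget-disconnected x′
                  (sameDiameter⇒connected mixed-answer (answer-isDiameter x′ (not ∘ x′)) mixed-connected))
    where
    mixed-connected : Connected (gadget x (not ∘ x′))
    mixed-connected = gadget-connected x (not ∘ x′) xr (cong not x′r)

    mixed-answer : IsDiameter (gadget x (not ∘ x′)) (answer (gadget x′ (not ∘ x′)))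
    mixed-answer = subst (IsDiameter _) (answer-swap eq) (answer-isDiameter x (not ∘ x′))

  transcript-injective : ∀ {x x′} → transcript x ≡ transcript x′ → x ≗ x′
  transcript-injective eq r =
    ≡true-⇔⇒≡ (transcript-≡⇒⊆ eq) (transcript-≡⇒⊆ (Eq.sym eq))

  input≤memory : m ≤ s * (p * 2)
  input≤memory = 2^-cancel-≤ (subst (2 ^ m ≤_) (^-*-assoc 2 s (p * 2))
                                   (bitString-injection⇒2^≤ code code-injective))
    where
    code : (Fin m → Bool) → Fin ((2 ^ s) ^ (p * 2))
    code = funToFin ∘ lookup ∘ transcript

    code-injective : ∀ {x x′} → code x ≡ code x′ → x ≗ x′
    code-injective {x} {x′} =
      transcript-injective ∘ funToFin∘lookup-injective (transcript x) (transcript x′)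

theorem17 : ∀ (k : ℕ) → 3 ≤ k →
    Σ ℕ λ C → Σ ℕ λ N → (1 ≤ C) ×
      (∀ (n p s : ℕ) → N ≤ n → (A : VAAlgorithm n p s) → SolvesDiameterVC k A →
        n ≤ C * (p * s))
theorem17 k 3≤k = 6 , 5 , s≤s z≤n , bound
  where
  bound : ∀ n p s → 5 ≤ n → (A : VAAlgorithm n p s) → SolvesDiameterVC k A → n ≤ 6 * (p * s)
  bound (suc (suc (suc (suc m)))) p s (s≤s (s≤s (s≤s (s≤s 1≤m)))) A solves =
    4+m≤6*t {t = p * s} 1≤m (subst (m ≤_) (*-double-comm p s) (input≤memory 3≤k A solves))
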